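{- Consider the construction described in the context. For all distinct $i,j\in[k]$ and all $i',j'\in[n]$: (1) $d(u'_{i,i'},u_{i,i'})+d(u_{i,i'},u'_{j,j'})>(1+\alpha)\cdot d(u'_{i,i'},u'_{j,j'})$; (2) $d(u'_{j,j'},u_{j,j'})+d(u_{j,j'},u'_{i,i'})>(1+\alpha)\cdot d(u'_{i,i'},u'_{j,j'})$.
   Context: Fix integers $k\ge 2$ and odd $n$, and rational $\alpha$ with $0<\alpha\le 0.5$; set $L=\lceil n/(2\alpha)\rceil$, $L_p=\lceil (n-1)/\alpha\rceil$. The graph $G'$ (unweighted; $d$ denotes its shortest-path distance) is built as follows: a vertex $b$; for each $i\in[k]$: vertices $u'_{i,1},\dots,u'_{i,n}$ forming a path in this order, vertices $u_{i,1},\dots,u_{i,n}$ forming a path in this order, a vertex $z_i$ adjacent to $u'_{i,1}$ and $u_{i,n}$, a vertex $z'_i$ adjacent to $u'_{i,n}$ and $u_{i,1}$, and a vertex $p_i$ joined to $u_{i,(n+1)/2}$ by a path with $L_p-1$ new internal vertices; for each $i\in[k]$, $j\in[n]$: a path from $u_{i,j}$ to $b$ with $L-1$ new internal vertices and a path from $u'_{i,j}$ to $b$ with $L-1$ new internal vertices. -}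

module Defs where

open import Data.Nat as ℕ using (ℕ; zero; suc; _∸_; _≤_; _+_)
open import Data.Fin using (Fin; toℕ)
open import Data.Integer using (+_; ∣_∣)
open import Data.Rational using (ℚ; 0ℚ; _/_; _*_; _<_; ½; 1/_; ceiling; positive)
open import Data.Rational.Properties using (pos⇒nonZero)
open import Data.Product using (_×_)
open import Data.Sum using (_⊎_)
open import Relation.Binary.PropositionalEquality using (_≡_)

ℕ→ℚ : ℕ → ℚ
ℕ→ℚ m = + m / 1

inv : (α : ℚ) → 0ℚ < α → ℚ
inv α α>0 = (1/ α) {{pos⇒nonZero α {{positive α>0}}}}

Lof : (n : ℕ) (α : ℚ) → 0ℚ < α → ℕ
Lof n α α>0 = ∣ ceiling (ℕ→ℚ n * ½ * inv α α>0) ∣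

Lpof : (n : ℕ) (α : ℚ) → 0ℚ < α → ℕ
Lpof n α α>0 = ∣ ceiling (ℕ→ℚ (n ∸ 1) * inv α α>0) ∣

-- The graph G'.  Indices i ∈ [k], j ∈ [n] are represented by Fin k, Fin n
-- (Fin index t stands for t+1).
module Construction (k n : ℕ) (α : ℚ) (α>0 : 0ℚ < α) where

  L : ℕ
  L = Lof n α α>0

  Lp : ℕ
  Lp = Lpof n α α>0

  data V : Set where
    b     : V
    u' u  : Fin k → Fin n → V
    z z'  : Fin k → V
    -- pv i t : vertex at distance (toℕ t + 1) from u_{i,(n+1)/2} on the
    -- path towards p_i; p_i itself is the one with toℕ t + 1 = L_p.
    pv    : Fin k → Fin Lp → V
    -- bu i j t / bu' i j t : internal vertex at distance (toℕ t + 1)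
    -- from u_{i,j} / u'_{i,j} on its path to b (L-1 internal vertices).
    bu bu' : Fin k → Fin n → Fin (L ∸ 1) → V

  data Edge : V → V → Set where
    e-u'  : ∀ i j j' → toℕ j' ≡ suc (toℕ j) → Edge (u' i j) (u' i j')
    e-u   : ∀ i j j' → toℕ j' ≡ suc (toℕ j) → Edge (u i j) (u i j')
    e-z₁  : ∀ i j → toℕ j ≡ 0 → Edge (z i) (u' i j)
    e-z₂  : ∀ i j → suc (toℕ j) ≡ n → Edge (z i) (u i j)
    e-z'₁ : ∀ i j → suc (toℕ j) ≡ n → Edge (z' i) (u' i j)
    e-z'₂ : ∀ i j → toℕ j ≡ 0 → Edge (z' i) (u i j)
    e-p₀  : ∀ i j t → suc (toℕ j + toℕ j) ≡ n → toℕ t ≡ 0 → Edge (u i j) (pv i t)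
    e-p   : ∀ i t t' → toℕ t' ≡ suc (toℕ t) → Edge (pv i t) (pv i t')
    e-bu-direct : ∀ i j → L ≡ 1 → Edge (u i j) b
    e-bu₀ : ∀ i j t → toℕ t ≡ 0 → Edge (u i j) (bu i j t)
    e-bu  : ∀ i j t t' → toℕ t' ≡ suc (toℕ t) → Edge (bu i j t) (bu i j t')
    e-bu₁ : ∀ i j t → suc (toℕ t) ≡ L ∸ 1 → Edge (bu i j t) b
    e-bu'-direct : ∀ i j → L ≡ 1 → Edge (u' i j) b
    e-bu'₀ : ∀ i j t → toℕ t ≡ 0 → Edge (u' i j) (bu' i j t)
    e-bu'  : ∀ i j t t' → toℕ t' ≡ suc (toℕ t) → Edge (bu' i j t) (bu' i j t')
    e-bu'₁ : ∀ i j t → suc (toℕ t) ≡ L ∸ 1 → Edge (bu' i j t) b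

  Adj : V → V → Set
  Adj x y = Edge x y ⊎ Edge y x

  data Walk : V → V → ℕ → Set where
    [] : ∀ {x} → Walk x x 0
    _∷_ : ∀ {x y w m} → Adj x y → Walk y w m → Walk x w (suc m)

  IsDist : V → V → ℕ → Set
  IsDist x y m = Walk x y m × (∀ m' → Walk x y m' → m ≤ m')

{-# OPTIONS --safe #-}
-- Lower bounds on distances come from potentials that change by at most 1 along
-- every edge, so that no walk is shorter than the drop of the potential along it.
-- The potential equal to 2L on gadget i, 0 on all other gadgets, L at b and linear
-- along the spokes shows that leaving gadget i costs at least 2L; the distance from
-- u'_{i,i'} around the (2n+2)-cycle of gadget i, capped at n+1, shows
-- d(u'_{i,i'}, u_{i,i'}) ≥ n+1.  Going through b gives d(u'_{i,i'}, u'_{j,j'}) ≤ 2L.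
-- Since L < n/(2α) + 1 we get 2αL < n + 2α ≤ n + 1, so (1+α)·2L < 2L + n + 1.
module Submission where

open import Defs

module RationalEstimates where
  open import Data.Nat as ℕ using (ℕ; suc)
  import Data.Nat.Coprimality as Coprime
  open import Data.Integer as ℤ using (+_; +0; +[1+_]; -[1+_])
  import Data.Integer.Properties as ℤ
  open import Data.Integer.DivMod as ℤ using (a≡a%n+[a/n]*n; n%d<d)
  open import Data.Integer.Tactic.RingSolver using (solve-∀)
  open import Data.Rational as ℚ
    using (ℚ; mkℚ; 0ℚ; 1ℚ; ½; _+_; _-_; _*_; _≤_; _<_; *≤*; *<*; ceiling; ↥_; ↧_;
           Positive; NonNegative; positive; nonNegative)
  open import Data.Rational.Properties
  import Data.Rational.Unnormalised as ℚᵘ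
  import Data.Rational.Unnormalised.Properties as ℚᵘ
  open import Data.Rational.Literals using (fromℤ)
  open import Data.Rational.Solver using (module +-*-Solver)
  open import Relation.Binary.PropositionalEquality

  open +-*-Solver using (solve; _:+_; _:*_; _:-_; _:=_; con)

  ℕ→ℚ≡fromℤ : ∀ m → ℕ→ℚ m ≡ fromℤ (+ m)
  ℕ→ℚ≡fromℤ m = normalize-coprime (Coprime.sym (Coprime.1-coprimeTo m))

  fromℤ-+ : ∀ i j → fromℤ (i ℤ.+ j) ≡ fromℤ i + fromℤ j
  fromℤ-+ i j = toℚᵘ-injective (ℚᵘ.≃-trans (ℚᵘ.*≡* eq) (ℚᵘ.≃-sym (toℚᵘ-homo-+ (fromℤ i) (fromℤ j))))
    where
    eq : (i ℤ.+ j) ℤ.* + 1 ≡ (i ℤ.* + 1 ℤ.+ j ℤ.* + 1) ℤ.* + 1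
    eq = cong (ℤ._* + 1) (sym (cong₂ ℤ._+_ (ℤ.*-identityʳ i) (ℤ.*-identityʳ j)))

  fromℤ-cancel-≤ : ∀ {i j} → fromℤ i ≤ fromℤ j → i ℤ.≤ j
  fromℤ-cancel-≤ {i} {j} (*≤* i≤j) = subst₂ ℤ._≤_ (ℤ.*-identityʳ i) (ℤ.*-identityʳ j) i≤j

  ℕ→ℚ-mono-≤ : ∀ {m o} → m ℕ.≤ o → ℕ→ℚ m ≤ ℕ→ℚ o
  ℕ→ℚ-mono-≤ {m} {o} m≤o = subst₂ _≤_ (sym (ℕ→ℚ≡fromℤ m)) (sym (ℕ→ℚ≡fromℤ o))
    (*≤* (ℤ.*-monoʳ-≤-nonNeg (+ 1) (ℤ.+≤+ m≤o)))

  ℕ→ℚ-+ : ∀ m o → ℕ→ℚ (m ℕ.+ o) ≡ ℕ→ℚ m + ℕ→ℚ o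
  ℕ→ℚ-+ m o = begin
    ℕ→ℚ (m ℕ.+ o)               ≡⟨ ℕ→ℚ≡fromℤ (m ℕ.+ o) ⟩
    fromℤ (+ m ℤ.+ + o)         ≡⟨ fromℤ-+ (+ m) (+ o) ⟩
    fromℤ (+ m) + fromℤ (+ o)   ≡⟨ cong₂ _+_ (ℕ→ℚ≡fromℤ m) (ℕ→ℚ≡fromℤ o) ⟨
    ℕ→ℚ m + ℕ→ℚ o               ∎
    where open ≡-Reasoning

  ceiling-unfold : ∀ p → ceiling p ≡ ℤ.- ((ℤ.- ↥ p) ℤ./ ↧ p)
  ceiling-unfold (mkℚ +[1+ _ ] _ _) = refl
  ceiling-unfold (mkℚ +0       _ _) = refl
  ceiling-unfold (mkℚ -[1+ _ ] _ _) = refl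

  p≤⌈p⌉ : ∀ p → p ≤ fromℤ (ceiling p)
  p≤⌈p⌉ p@(mkℚ N d-1 _) = *≤* (begin
    N ℤ.* + 1             ≡⟨ ℤ.*-identityʳ N ⟩
    N                     ≡⟨ ℤ.neg-involutive N ⟨
    ℤ.- (ℤ.- N)           ≡⟨ cong ℤ.-_ (a≡a%n+[a/n]*n (ℤ.- N) D) ⟩
    ℤ.- (+ r ℤ.+ f ℤ.* D) ≤⟨ ℤ.neg-mono-≤ (ℤ.i≤j+i (f ℤ.* D) (+ r)) ⟩
    ℤ.- (f ℤ.* D)         ≡⟨ ℤ.neg-distribˡ-* f D ⟩
    ℤ.- f ℤ.* D           ≡⟨ cong (ℤ._* D) (ceiling-unfold p) ⟨
    ceiling p ℤ.* D       ∎)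
    where
    open ℤ.≤-Reasoning
    D = + suc d-1
    f = ℤ.- N ℤ./ D
    r = ℤ.- N ℤ.% D

  ⌈p⌉-1<p : ∀ p → fromℤ (ceiling p) - 1ℚ < p
  ⌈p⌉-1<p p@(mkℚ N d-1 _) = subst (_< p) (fromℤ-+ (ceiling p) (ℤ.- + 1)) (*<* (begin-strict
    (ceiling p ℤ.- + 1) ℤ.* D       ≡⟨ cong (λ z → (z ℤ.- + 1) ℤ.* D) (ceiling-unfold p) ⟩
    (ℤ.- f ℤ.- + 1) ℤ.* D           ≡⟨ shuffle f D ⟩
    ℤ.- (D ℤ.+ f ℤ.* D)             <⟨ ℤ.neg-mono-< (ℤ.+-monoˡ-< (f ℤ.* D) (ℤ.+<+ (n%d<d (ℤ.- N) D))) ⟩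
    ℤ.- (+ r ℤ.+ f ℤ.* D)           ≡⟨ cong ℤ.-_ (a≡a%n+[a/n]*n (ℤ.- N) D) ⟨
    ℤ.- (ℤ.- N)                     ≡⟨ ℤ.neg-involutive N ⟩
    N                               ≡⟨ ℤ.*-identityʳ N ⟨
    N ℤ.* + 1                       ∎))
    where
    open ℤ.≤-Reasoning
    D = + suc d-1
    f = ℤ.- N ℤ./ D
    r = ℤ.- N ℤ.% D
    shuffle : ∀ f D → (ℤ.- f ℤ.- + 1) ℤ.* D ≡ ℤ.- (D ℤ.+ f ℤ.* D)
    shuffle = solve-∀

  module Parameters (n : ℕ) (α : ℚ) (α>0 : 0ℚ < α) (α≤½ : α ≤ ½) where
    instance
      α-positive : Positive α
      α-positive = positive α>0
      α-nonZero : ℚ.NonZero α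
      α-nonZero = pos⇒nonZero α

    L : ℕ
    L = Lof n α α>0

    ν ℓ x : ℚ
    ν = ℕ→ℚ n
    ℓ = ℕ→ℚ L
    x = ν * ½ * inv α α>0

    2α≤1 : α + α ≤ 1ℚ
    2α≤1 = +-mono-≤ α≤½ α≤½

    2αx≡ν : (α + α) * x ≡ ν
    2αx≡ν = begin
      (α + α) * (ν * ½ * β)     ≡⟨ regroup ν β α ⟩
      ν * (α * β) * (½ + ½)     ≡⟨ cong (λ t → ν * t * 1ℚ) (*-inverseʳ α) ⟩
      ν * 1ℚ * 1ℚ               ≡⟨ trans (*-identityʳ (ν * 1ℚ)) (*-identityʳ ν) ⟩
      ν                         ∎
      where
      open ≡-Reasoning
      β = inv α α>0
      regroup : ∀ ν β α → (α + α) * (ν * ½ * β) ≡ ν * (α * β) * (½ + ½)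
      regroup = solve 3 (λ ν β α → (α :+ α) :* (ν :* con ½ :* β) := ν :* (α :* β) :* (con ½ :+ con ½)) refl

    x≥0 : 0ℚ ≤ x
    x≥0 = nonNegative⁻¹ x {{nonNeg*nonNeg⇒nonNeg (ν * ½) (inv α α>0)}}
      where instance
      ν-nonNeg : NonNegative ν
      ν-nonNeg = nonNegative (ℕ→ℚ-mono-≤ {0} {n} ℕ.z≤n)
      ν½-nonNeg : NonNegative (ν * ½)
      ν½-nonNeg = nonNeg*nonNeg⇒nonNeg ν ½
      β-nonNeg : NonNegative (inv α α>0)
      β-nonNeg = pos⇒nonNeg (inv α α>0) {{1/pos⇒pos α}}

    ν≤x : ν ≤ x
    ν≤x = begin
      ν              ≡⟨ 2αx≡ν ⟨
      (α + α) * x    ≤⟨ *-monoʳ-≤-nonNeg x {{nonNegative x≥0}} 2α≤1 ⟩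
      1ℚ * x         ≡⟨ *-identityˡ x ⟩
      x              ∎
      where open ≤-Reasoning

    ℓ≡⌈x⌉ : ℓ ≡ fromℤ (ceiling x)
    ℓ≡⌈x⌉ = trans (ℕ→ℚ≡fromℤ L) (cong fromℤ (ℤ.0≤i⇒+∣i∣≡i (fromℤ-cancel-≤ (≤-trans x≥0 (p≤⌈p⌉ x)))))

    x≤ℓ : x ≤ ℓ
    x≤ℓ = subst (x ≤_) (sym ℓ≡⌈x⌉) (p≤⌈p⌉ x)

    ℓ-1<x : ℓ - 1ℚ < x
    ℓ-1<x = subst (λ q → q - 1ℚ < x) (sym ℓ≡⌈x⌉) (⌈p⌉-1<p x)

    n≤L : n ℕ.≤ L
    n≤L = ℤ.drop‿+≤+ (fromℤ-cancel-≤ (subst₂ _≤_ (ℕ→ℚ≡fromℤ n) (ℕ→ℚ≡fromℤ L) (≤-trans ν≤x x≤ℓ)))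

    2αℓ<ν+1 : (α + α) * ℓ < ν + 1ℚ
    2αℓ<ν+1 = begin-strict
      (α + α) * ℓ                       ≡⟨ split α ℓ ⟩
      (α + α) * (ℓ - 1ℚ) + (α + α)      <⟨ +-monoˡ-< (α + α) (*-monoʳ-<-pos (α + α) {{2α-positive}} ℓ-1<x) ⟩
      (α + α) * x + (α + α)             ≡⟨ cong (_+ (α + α)) 2αx≡ν ⟩
      ν + (α + α)                       ≤⟨ +-monoʳ-≤ ν 2α≤1 ⟩
      ν + 1ℚ                            ∎
      where
      open ≤-Reasoning
      2α-positive : Positive (α + α)
      2α-positive = pos+pos⇒pos α α
      split : ∀ α ℓ → (α + α) * ℓ ≡ (α + α) * (ℓ - 1ℚ) + (α + α)
      split = solve 2 (λ α ℓ → (α :+ α) :* ℓ := (α :+ α) :* (ℓ :- con 1ℚ) :+ (α :+ α)) refl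

    [1+α]c<a+b : ∀ {a b c} → c ℕ.≤ L ℕ.+ L → suc n ℕ.+ (L ℕ.+ L) ℕ.≤ a ℕ.+ b →
              (1ℚ + α) * ℕ→ℚ c < ℕ→ℚ (a ℕ.+ b)
    [1+α]c<a+b {a} {b} {c} c≤2L a+b≥ = begin-strict
      (1ℚ + α) * ℕ→ℚ c                  ≤⟨ *-monoˡ-≤-nonNeg (1ℚ + α) {{1+α-nonNeg}} c≤2ℓ ⟩
      (1ℚ + α) * (ℓ + ℓ)                ≡⟨ expand α ℓ ⟩
      (ℓ + ℓ) + (α + α) * ℓ             <⟨ +-monoʳ-< (ℓ + ℓ) 2αℓ<ν+1 ⟩
      (ℓ + ℓ) + (ν + 1ℚ)                ≡⟨ collect ⟩
      ℕ→ℚ (suc n ℕ.+ (L ℕ.+ L))         ≤⟨ ℕ→ℚ-mono-≤ a+b≥ ⟩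
      ℕ→ℚ (a ℕ.+ b)                     ∎
      where
      open ≤-Reasoning
      1+α-nonNeg : NonNegative (1ℚ + α)
      1+α-nonNeg = pos⇒nonNeg (1ℚ + α) {{pos+pos⇒pos 1ℚ α}}
      c≤2ℓ : ℕ→ℚ c ≤ ℓ + ℓ
      c≤2ℓ = subst (ℕ→ℚ c ≤_) (ℕ→ℚ-+ L L) (ℕ→ℚ-mono-≤ c≤2L)
      expand : ∀ α ℓ → (1ℚ + α) * (ℓ + ℓ) ≡ (ℓ + ℓ) + (α + α) * ℓ
      expand = solve 2 (λ α ℓ → (con 1ℚ :+ α) :* (ℓ :+ ℓ) := (ℓ :+ ℓ) :+ (α :+ α) :* ℓ) refl
      collect : (ℓ + ℓ) + (ν + 1ℚ) ≡ ℕ→ℚ (suc n ℕ.+ (L ℕ.+ L))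
      collect = begin-equality
        (ℓ + ℓ) + (ν + 1ℚ)            ≡⟨ +-comm (ℓ + ℓ) (ν + 1ℚ) ⟩
        (ν + 1ℚ) + (ℓ + ℓ)            ≡⟨ cong₂ _+_ (trans (ℕ→ℚ-+ 1 n) (+-comm 1ℚ ν)) (ℕ→ℚ-+ L L) ⟨
        ℕ→ℚ (suc n) + ℕ→ℚ (L ℕ.+ L)   ≡⟨ ℕ→ℚ-+ (suc n) (L ℕ.+ L) ⟨
        ℕ→ℚ (suc n ℕ.+ (L ℕ.+ L))     ∎

module DistanceBounds where
  open import Data.Bool using (Bool; true; false; if_then_else_)
  open import Data.Nat as ℕ
    using (ℕ; zero; suc; _+_; _∸_; _⊓_; _≤_; z≤n; s≤s; ∣_-_∣; ⌊_/2⌋)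
  open import Data.Nat.Properties as ℕ
    using (≤-refl; ≤-trans; ≤-reflexive; n≤1+n; m≤n⇒m≤1+n; +-suc; +-identityʳ)
  open import Data.Fin using (Fin; toℕ; fromℕ<; _≟_)
  open import Data.Fin.Properties using (toℕ<n; toℕ-fromℕ<)
  open import Data.Rational using (ℚ; 0ℚ; _<_)
  open import Data.Product using (_×_; _,_; proj₁; proj₂)
  open import Data.Sum using (inj₁; inj₂)
  open import Relation.Nullary.Decidable using (does; dec-true; dec-false)
  open import Relation.Binary.PropositionalEquality

  Near : ℕ → ℕ → Set
  Near x y = x ≤ suc y × y ≤ suc x

  Near-reflexive : ∀ {x y} → x ≡ y → Near x y
  Near-reflexive {x} refl = n≤1+n x , n≤1+n x

  Near-refl : ∀ {x} → Near x x
  Near-refl = Near-reflexive refl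

  Near-sym : ∀ {x y} → Near x y → Near y x
  Near-sym (x≤1+y , y≤1+x) = y≤1+x , x≤1+y

  Near-suc : ∀ {x} → Near x (suc x)
  Near-suc {x} = m≤n⇒m≤1+n (n≤1+n x) , ≤-refl

  ≡suc⇒Near : ∀ {x y} → y ≡ suc x → Near x y
  ≡suc⇒Near refl = Near-suc

  Near-if : ∀ β {x x' y y'} → Near x x' → Near y y' →
            Near (if β then x else y) (if β then x' else y')
  Near-if true  x~x' _ = x~x'
  Near-if false _ y~y' = y~y'

  Near-+ˡ : ∀ c {x y} → Near x y → Near (c + x) (c + y)
  Near-+ˡ c {x} {y} (x≤1+y , y≤1+x) = shift x≤1+y , shift y≤1+x
    where
    shift : ∀ {x y} → x ≤ suc y → c + x ≤ suc (c + y)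
    shift {x} {y} x≤1+y = ≤-trans (ℕ.+-monoʳ-≤ c x≤1+y) (≤-reflexive (+-suc c y))

  Near-∸ˡ : ∀ c {x y} → Near x y → Near (c ∸ x) (c ∸ y)
  Near-∸ˡ c (x≤1+y , y≤1+x) = shift y≤1+x , shift x≤1+y
    where
    shift : ∀ {x y} → x ≤ suc y → c ∸ y ≤ suc (c ∸ x)
    shift {x} {y} x≤1+y = ℕ.m≤n+o⇒m∸n≤o c y (begin
      c                  ≤⟨ ℕ.m≤n+m∸n c x ⟩
      x + (c ∸ x)        ≤⟨ ℕ.+-monoˡ-≤ (c ∸ x) x≤1+y ⟩
      suc y + (c ∸ x)    ≡⟨ +-suc y (c ∸ x) ⟨
      y + suc (c ∸ x)    ∎)
      where open ℕ.≤-Reasoning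

  Near-⊓ˡ : ∀ c {x y} → Near x y → Near (c ⊓ x) (c ⊓ y)
  Near-⊓ˡ c (x≤1+y , y≤1+x) = shift x≤1+y , shift y≤1+x
    where
    shift : ∀ {x y} → x ≤ suc y → c ⊓ x ≤ suc (c ⊓ y)
    shift {x} {y} x≤1+y = ≤-trans (ℕ.⊓-monoʳ-≤ c x≤1+y) (ℕ.⊓-monoˡ-≤ (suc y) (n≤1+n c))

  Near-∣-∣ : ∀ a p → Near ∣ a - p ∣ ∣ suc a - p ∣
  Near-∣-∣ zero    zero    = Near-suc
  Near-∣-∣ zero    (suc p) = Near-sym Near-suc
  Near-∣-∣ (suc a) zero    = Near-suc
  Near-∣-∣ (suc a) (suc p) = Near-∣-∣ a p

  ⌊1+m+m/2⌋≡m : ∀ m → ⌊ suc (m + m) /2⌋ ≡ m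
  ⌊1+m+m/2⌋≡m zero    = refl
  ⌊1+m+m/2⌋≡m (suc m) = cong suc (trans (cong ⌊_/2⌋ (+-suc m m)) (⌊1+m+m/2⌋≡m m))

  m∸[m∸1]≤1 : ∀ m → m ∸ (m ∸ 1) ≤ 1
  m∸[m∸1]≤1 zero    = z≤n
  m∸[m∸1]≤1 (suc m) = ≤-reflexive (ℕ.m+n∸n≡m 1 m)

  module Bounds (k n : ℕ) (α : ℚ) (α>0 : 0ℚ < α) where
    open Construction k n α α>0

    Adj-sym : ∀ {x y} → Adj x y → Adj y x
    Adj-sym (inj₁ e) = inj₂ e
    Adj-sym (inj₂ e) = inj₁ e

    _∷ʳ_ : ∀ {x y w m} → Walk x y m → Adj y w → Walk x w (suc m)
    []      ∷ʳ e = e ∷ []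
    (d ∷ w) ∷ʳ e = d ∷ (w ∷ʳ e)

    reverse : ∀ {x y m} → Walk x y m → Walk y x m
    reverse []      = []
    reverse (e ∷ w) = reverse w ∷ʳ Adj-sym e

    _++_ : ∀ {x y w m m'} → Walk x y m → Walk y w m' → Walk x w (m + m')
    []      ++ w' = w'
    (e ∷ w) ++ w' = e ∷ (w ++ w')

    1-Lipschitz : (V → ℕ) → Set
    1-Lipschitz ψ = ∀ {x y} → Edge x y → Near (ψ x) (ψ y)

    1-Lipschitz⇒≤length+ : ∀ {ψ} → 1-Lipschitz ψ → ∀ {x y m} → Walk x y m → ψ x ≤ m + ψ y
    1-Lipschitz⇒≤length+ lip []           = ≤-refl
    1-Lipschitz⇒≤length+ lip (inj₁ e ∷ w) = ≤-trans (proj₁ (lip e)) (s≤s (1-Lipschitz⇒≤length+ lip w))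
    1-Lipschitz⇒≤length+ lip (inj₂ e ∷ w) = ≤-trans (proj₂ (lip e)) (s≤s (1-Lipschitz⇒≤length+ lip w))

    module _ (l : Fin k) (j : Fin n) where
      toward-b : ∀ r (r<L∸1 : r ℕ.< L ∸ 1) → Walk (u' l j) (bu' l j (fromℕ< r<L∸1)) (suc r)
      toward-b zero    0<L∸1   = inj₁ (e-bu'₀ l j _ (toℕ-fromℕ< 0<L∸1)) ∷ []
      toward-b (suc r) 1+r<L∸1 =
        toward-b r r<L∸1 ∷ʳ inj₁ (e-bu' l j _ _ (trans (toℕ-fromℕ< 1+r<L∸1) (cong suc (sym (toℕ-fromℕ< r<L∸1)))))
        where
        r<L∸1 : r ℕ.< L ∸ 1
        r<L∸1 = ≤-trans (n≤1+n (suc r)) 1+r<L∸1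

      spoke : 1 ≤ L → Walk (u' l j) b L
      spoke L≥1 = subst (Walk (u' l j) b) 1+[L∸1]≡L (ending-at (L ∸ 1) refl)
        where
        1+[L∸1]≡L : suc (L ∸ 1) ≡ L
        1+[L∸1]≡L = ℕ.m+[n∸m]≡n L≥1
        ending-at : ∀ r → L ∸ 1 ≡ r → Walk (u' l j) b (suc r)
        ending-at zero    L∸1≡0   = inj₁ (e-bu'-direct l j (trans (sym 1+[L∸1]≡L) (cong suc L∸1≡0))) ∷ []
        ending-at (suc r) L∸1≡1+r =
          toward-b r r<L∸1 ∷ʳ inj₁ (e-bu'₁ l j _ (trans (cong suc (toℕ-fromℕ< r<L∸1)) (sym L∸1≡1+r)))
          where
          r<L∸1 : r ℕ.< L ∸ 1
          r<L∸1 = subst (r ℕ.<_) (sym L∸1≡1+r) (ℕ.n<1+n r)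

    via-b-≤ : ∀ {l l' j j' c} → 1 ≤ L → IsDist (u' l j) (u' l' j') c → c ≤ L + L
    via-b-≤ {l} {l'} {j} {j'} L≥1 (_ , minimal) = minimal (L + L) (spoke l j L≥1 ++ reverse (spoke l' j' L≥1))

    height : V → ℕ
    height b            = 0
    height (bu _ _ t)   = L ∸ suc (toℕ t)
    height (bu' _ _ t)  = L ∸ suc (toℕ t)
    height _            = L

    height-step : ∀ {s s'} → s' ≡ suc s → Near (L ∸ s) (L ∸ s')
    height-step s'≡1+s = Near-∸ˡ L (≡suc⇒Near s'≡1+s)

    height-top : ∀ {s} → s ≡ L ∸ 1 → L ∸ s ≤ 1
    height-top refl = m∸[m∸1]≤1 L

    module _ (i : Fin k) where
      is-i : Fin k → Bool
      is-i l = does (l ≟ i)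

      inside : V → Bool
      inside b            = false
      inside (u' l _)     = is-i l
      inside (u l _)      = is-i l
      inside (z l)        = is-i l
      inside (z' l)       = is-i l
      inside (pv l _)     = is-i l
      inside (bu l _ _)   = is-i l
      inside (bu' l _ _)  = is-i l

      φ : V → ℕ
      φ x = if inside x then L + height x else L ∸ height x

      Near-φ : ∀ β {h h'} → Near h h' →
               Near (if β then L + h else L ∸ h) (if β then L + h' else L ∸ h')
      Near-φ β h~h' = Near-if β (Near-+ˡ L h~h') (Near-∸ˡ L h~h')

      Near-φ-b : ∀ β {h} → h ≤ 1 → Near (if β then L + h else L ∸ h) L
      Near-φ-b true  h≤1 = subst (Near _) (+-identityʳ L) (Near-+ˡ L (h≤1 , z≤n))
      Near-φ-b false h≤1 = Near-∸ˡ L (h≤1 , z≤n)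

      φ-1-Lipschitz : 1-Lipschitz φ
      φ-1-Lipschitz (e-u' l _ _ _)          = Near-φ (is-i l) Near-refl
      φ-1-Lipschitz (e-u l _ _ _)           = Near-φ (is-i l) Near-refl
      φ-1-Lipschitz (e-z₁ l _ _)            = Near-φ (is-i l) Near-refl
      φ-1-Lipschitz (e-z₂ l _ _)            = Near-φ (is-i l) Near-refl
      φ-1-Lipschitz (e-z'₁ l _ _)           = Near-φ (is-i l) Near-refl
      φ-1-Lipschitz (e-z'₂ l _ _)           = Near-φ (is-i l) Near-refl
      φ-1-Lipschitz (e-p₀ l _ _ _ _)        = Near-φ (is-i l) Near-refl
      φ-1-Lipschitz (e-p l _ _ _)           = Near-φ (is-i l) Near-refl
      φ-1-Lipschitz (e-bu-direct l _ L≡1)   = Near-φ-b (is-i l) (≤-reflexive L≡1)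
      φ-1-Lipschitz (e-bu₀ l _ _ t≡0)       = Near-φ (is-i l) (height-step (cong suc t≡0))
      φ-1-Lipschitz (e-bu l _ _ _ t'≡1+t)   = Near-φ (is-i l) (height-step (cong suc t'≡1+t))
      φ-1-Lipschitz (e-bu₁ l _ _ t+1≡)      = Near-φ-b (is-i l) (height-top t+1≡)
      φ-1-Lipschitz (e-bu'-direct l _ L≡1)  = Near-φ-b (is-i l) (≤-reflexive L≡1)
      φ-1-Lipschitz (e-bu'₀ l _ _ t≡0)      = Near-φ (is-i l) (height-step (cong suc t≡0))
      φ-1-Lipschitz (e-bu' l _ _ _ t'≡1+t)  = Near-φ (is-i l) (height-step (cong suc t'≡1+t))
      φ-1-Lipschitz (e-bu'₁ l _ _ t+1≡)     = Near-φ-b (is-i l) (height-top t+1≡)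

      cross-gadget-≥ : ∀ {l i' j' m} → l ≢ i → Walk (u i i') (u' l j') m → L + L ≤ m
      cross-gadget-≥ {l} {i'} {j'} {m} l≢i w = begin
        L + L           ≡⟨ cong (if_then L + L else L ∸ L) (dec-true (i ≟ i) refl) ⟨
        φ (u i i')      ≤⟨ 1-Lipschitz⇒≤length+ φ-1-Lipschitz w ⟩
        m + φ (u' l j') ≡⟨ cong (λ β → m + (if β then L + L else L ∸ L)) (dec-false (l ≟ i) l≢i) ⟩
        m + (L ∸ L)     ≡⟨ cong (m +_) (ℕ.n∸n≡0 L) ⟩
        m + 0           ≡⟨ +-identityʳ m ⟩
        m               ∎
        where open ℕ.≤-Reasoning

      module _ (i' : Fin n) (n≤L : n ≤ L) where
        p : ℕ
        p = toℕ i'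

        p<n : p ℕ.< n
        p<n = toℕ<n i'

        offset : ℕ → ℕ
        offset a = ∣ a - p ∣

        ψu' ψu : Fin k → Fin n → ℕ
        ψu' l t = if is-i l then offset (toℕ t) else suc n
        ψu  l t = if is-i l then suc n ∸ offset (toℕ t) else suc n

        cap : ℕ → ℕ
        cap m = suc n ⊓ m

        -- Gadget i's cycle is z, u'₀ … u'ₙ₋₁, z', u₀ … uₙ₋₁, and u_{i,i'} is the
        -- antipode of u'_{i,i'} on it.
        ψ : V → ℕ
        ψ b             = n
        ψ (u' l t)      = ψu' l t
        ψ (u l t)       = ψu l t
        ψ (z l)         = if is-i l then suc p else suc n
        ψ (z' l)        = if is-i l then n ∸ p else suc n
        ψ (pv l _)      = if is-i l then suc n ∸ offset ⌊ n /2⌋ else suc n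
        ψ (bu l j t)    = cap (ψu l j + suc (toℕ t))
        ψ (bu' l j t)   = cap (ψu' l j + suc (toℕ t))

        ψu'≤1+n : ∀ l t → ψu' l t ≤ suc n
        ψu'≤1+n l t with is-i l
        ... | true  = ≤-trans (ℕ.∣m-n∣≤m⊔n (toℕ t) p) (m≤n⇒m≤1+n (ℕ.⊔-lub (ℕ.<⇒≤ (toℕ<n t)) (ℕ.<⇒≤ p<n)))
        ... | false = ≤-refl

        ψu≤1+n : ∀ l t → ψu l t ≤ suc n
        ψu≤1+n l t with is-i l
        ... | true  = ℕ.m∸n≤m (suc n) (offset (toℕ t))
        ... | false = ≤-refl

        Near-cap : ∀ {m} → n ≤ suc m → Near (cap m) n
        Near-cap {m} n≤1+m = ℕ.m⊓n≤m (suc n) m , ℕ.⊓-glb (m≤n⇒m≤1+n (n≤1+n n)) n≤1+m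

        spoke-direct : ∀ {A} → A ≤ suc n → L ≡ 1 → Near A n
        spoke-direct A≤1+n L≡1 = A≤1+n , ≤-trans n≤L (≤-trans (≤-reflexive L≡1) (s≤s z≤n))

        spoke-start : ∀ {A s} → A ≤ suc n → s ≡ 1 → Near A (cap (A + s))
        spoke-start {A} {s} A≤1+n s≡1 =
          subst (λ A' → Near A' (cap (A + s))) cap[A+0]≡A (Near-⊓ˡ (suc n) (Near-+ˡ A (≡suc⇒Near s≡1)))
          where
          cap[A+0]≡A : cap (A + 0) ≡ A
          cap[A+0]≡A = trans (cong cap (+-identityʳ A)) (ℕ.m≥n⇒m⊓n≡n A≤1+n)

        spoke-step : ∀ {A s s'} → s' ≡ suc s → Near (cap (A + s)) (cap (A + s'))
        spoke-step {A} s'≡1+s = Near-⊓ˡ (suc n) (Near-+ˡ A (≡suc⇒Near s'≡1+s))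

        spoke-end : ∀ {A s} → s ≡ L ∸ 1 → Near (cap (A + s)) n
        spoke-end {A} refl = Near-cap (≤-trans n≤L (≤-trans (ℕ.m≤n+m∸n L 1) (s≤s (ℕ.m≤n+m (L ∸ 1) A))))

        row-step : ∀ {a a'} → a' ≡ suc a → Near (offset a) (offset a')
        row-step {a} refl = Near-∣-∣ a p

        z-u' : ∀ {a} → a ≡ 0 → Near (suc p) (offset a)
        z-u' refl = Near-sym Near-suc

        z-u : ∀ {a} → suc a ≡ n → Near (suc p) (suc n ∸ offset a)
        z-u {a} refl = subst (Near (suc p)) (sym 2+a∸offset≡2+p) Near-suc
          where
          p≤a : p ≤ a
          p≤a = ℕ.≤-pred p<n
          2+a∸offset≡2+p : suc (suc a) ∸ offset a ≡ suc (suc p)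
          2+a∸offset≡2+p = begin
            2 + a ∸ offset a          ≡⟨ cong (2 + a ∸_) (ℕ.m≤n⇒∣n-m∣≡n∸m p≤a) ⟩
            2 + a ∸ (a ∸ p)           ≡⟨ ℕ.+-∸-assoc 2 (ℕ.m∸n≤m a p) ⟩
            2 + (a ∸ (a ∸ p))         ≡⟨ cong (2 +_) (ℕ.m∸[m∸n]≡n p≤a) ⟩
            2 + p                     ∎
            where open ≡-Reasoning

        z'-u' : ∀ {a} → suc a ≡ n → Near (n ∸ p) (offset a)
        z'-u' {a} refl = subst₂ Near (sym (ℕ.+-∸-assoc 1 p≤a)) (sym (ℕ.m≤n⇒∣n-m∣≡n∸m p≤a)) (Near-sym Near-suc)
          where
          p≤a : p ≤ a
          p≤a = ℕ.≤-pred p<n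

        z'-u : ∀ {a} → a ≡ 0 → Near (n ∸ p) (suc n ∸ offset a)
        z'-u refl = subst (Near (n ∸ p)) (sym (ℕ.+-∸-assoc 1 (ℕ.<⇒≤ p<n))) Near-suc

        pendant : ∀ {a} → suc (a + a) ≡ n → Near (suc n ∸ offset a) (suc n ∸ offset ⌊ n /2⌋)
        pendant {a} refl = Near-reflexive (cong (λ c → suc n ∸ offset c) (sym (⌊1+m+m/2⌋≡m a)))

        ψ-1-Lipschitz : 1-Lipschitz ψ
        ψ-1-Lipschitz (e-u' l _ _ t'≡1+t)     = Near-if (is-i l) (row-step t'≡1+t) Near-refl
        ψ-1-Lipschitz (e-u l _ _ t'≡1+t)      = Near-if (is-i l) (Near-∸ˡ (suc n) (row-step t'≡1+t)) Near-refl
        ψ-1-Lipschitz (e-z₁ l _ t≡0)          = Near-if (is-i l) (z-u' t≡0) Near-refl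
        ψ-1-Lipschitz (e-z₂ l _ t+1≡n)        = Near-if (is-i l) (z-u t+1≡n) Near-refl
        ψ-1-Lipschitz (e-z'₁ l _ t+1≡n)       = Near-if (is-i l) (z'-u' t+1≡n) Near-refl
        ψ-1-Lipschitz (e-z'₂ l _ t≡0)         = Near-if (is-i l) (z'-u t≡0) Near-refl
        ψ-1-Lipschitz (e-p₀ l j _ mid _)      = Near-if (is-i l) (pendant {toℕ j} mid) Near-refl
        ψ-1-Lipschitz (e-p _ _ _ _)           = Near-refl
        ψ-1-Lipschitz (e-bu-direct l j L≡1)   = spoke-direct (ψu≤1+n l j) L≡1
        ψ-1-Lipschitz (e-bu₀ l j _ t≡0)       = spoke-start (ψu≤1+n l j) (cong suc t≡0)
        ψ-1-Lipschitz (e-bu _ _ _ _ t'≡1+t)   = spoke-step (cong suc t'≡1+t)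
        ψ-1-Lipschitz (e-bu₁ _ _ _ t+1≡)      = spoke-end t+1≡
        ψ-1-Lipschitz (e-bu'-direct l j L≡1)  = spoke-direct (ψu'≤1+n l j) L≡1
        ψ-1-Lipschitz (e-bu'₀ l j _ t≡0)      = spoke-start (ψu'≤1+n l j) (cong suc t≡0)
        ψ-1-Lipschitz (e-bu' _ _ _ _ t'≡1+t)  = spoke-step (cong suc t'≡1+t)
        ψ-1-Lipschitz (e-bu'₁ _ _ _ t+1≡)     = spoke-end t+1≡

        antipode-≥ : ∀ {m} → Walk (u' i i') (u i i') m → suc n ≤ m
        antipode-≥ {m} w = subst₂ _≤_ ψ[u]≡1+n (trans (cong (m +_) ψ[u']≡0) (+-identityʳ m))
                             (1-Lipschitz⇒≤length+ ψ-1-Lipschitz (reverse w))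
          where
          ψ[u]≡1+n : ψu i i' ≡ suc n
          ψ[u]≡1+n rewrite dec-true (i ≟ i) refl | ℕ.∣n-n∣≡0 p = refl
          ψ[u']≡0 : ψu' i i' ≡ 0
          ψ[u']≡0 rewrite dec-true (i ≟ i) refl | ℕ.∣n-n∣≡0 p = refl

open import Data.Nat using (ℕ; _≤_; _+_)
open import Data.Nat as N using ()
open import Data.Fin using (Fin)
open import Data.Rational using (ℚ; 0ℚ; 1ℚ; ½; _<_; _*_)
open import Data.Product using (_×_; ∃)
open import Relation.Binary.PropositionalEquality using (_≡_; _≢_)
open import Data.Nat using (z≤n; s≤s)
open import Data.Nat.Properties using (≤-trans; +-mono-≤)
open import Data.Fin.Properties using (toℕ<n)
open import Data.Product using (_,_; proj₁; proj₂)
open import Function using (_∘_)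
open import Relation.Binary.PropositionalEquality using (sym)
open RationalEstimates using (module Parameters)
open DistanceBounds using (module Bounds)

lemma8 : (k n : ℕ) (α : ℚ) (α>0 : 0ℚ < α) → α Data.Rational.≤ ½ →
           2 ≤ k → ∃ (λ m → n ≡ 1 + 2 N.* m) →
           let open Construction k n α α>0 in
           (i j : Fin k) → i ≢ j → (i' j' : Fin n) →
           (a b c e f : ℕ) →
           IsDist (u' i i') (u i i') a →
           IsDist (u i i') (u' j j') b →
           IsDist (u' i i') (u' j j') c →
           IsDist (u' j j') (u j j') e →
           IsDist (u j j') (u' i i') f →
           ((1ℚ Data.Rational.+ α) * ℕ→ℚ c < ℕ→ℚ (a + b))
           × ((1ℚ Data.Rational.+ α) * ℕ→ℚ c < ℕ→ℚ (e + f))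
lemma8 k n α α>0 α≤½ _ _ i j i≢j i' j' a b c e f da db dc de df =
    [1+α]c<a+b {a} {b} c≤2L
      (+-mono-≤ (antipode-≥ i i' n≤L (proj₁ da)) (cross-gadget-≥ i (i≢j ∘ sym) (proj₁ db)))
  , [1+α]c<a+b {e} {f} c≤2L
      (+-mono-≤ (antipode-≥ j j' n≤L (proj₁ de)) (cross-gadget-≥ j i≢j (proj₁ df)))
  where
  open Parameters n α α>0 α≤½
  open Bounds k n α α>0
  L≥1 : 1 ≤ L
  L≥1 = ≤-trans (s≤s z≤n) (≤-trans (toℕ<n i') n≤L)
  c≤2L : c ≤ L + L
  c≤2L = via-b-≤ L≥1 dc
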